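{- Let $d>1$ be a square-free integer, let $\varepsilon=a+b\sqrt{d}$ ($a,b\in\mathbb{Q}$) be the fundamental unit of $\mathbb{Q}(\sqrt{d})$, and for $n\ge1$ write $\varepsilon^n=a_n+b_n\sqrt{d}$ with $a_n,b_n\in\mathbb{Q}$ and $L_n=a_n/a$. The following are equivalent: (i) $L_{n+2}=L_n+L_{n+1}$ for all $n\ge1$; (ii) $L_3=L_1+L_2$; (iii) $d=5$ and $\varepsilon=\frac{1+\sqrt5}{2}$.
   Context: The fundamental unit $\varepsilon$ of the real quadratic field $\mathbb{Q}(\sqrt{d})$ is the unit $\varepsilon>1$ of its ring of integers $\mathcal{O}$ such that $\mathcal{O}^*=\{\pm\varepsilon^l: l\in\mathbb{Z}\}$. -}

module Defs where

open import Data.Nat as ℕ using (ℕ; suc; zero)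
open import Data.Nat.Divisibility using (_∣_)
open import Data.Integer as ℤ using (ℤ; +_; -[1+_])
open import Data.Rational as ℚ using (ℚ; 0ℚ; 1ℚ; _+_; _*_; _-_; -_; _≤_; _<_; _÷_)
open import Data.Rational.Properties using (_≟_)
open import Data.Product using (_×_; _,_; proj₁; proj₂; ∃-syntax)
open import Data.Sum using (_⊎_)
open import Relation.Binary.PropositionalEquality using (_≡_; _≢_)
open import Relation.Nullary using (yes; no)

SquareFree : ℕ → Set
SquareFree d = ∀ (p : ℕ) → p ℕ.* p ∣ d → p ≡ 1

-- Elements x + y√d of ℚ(√d), represented by the pair (x , y)
QF : Set
QF = ℚ × ℚ

dQ : ℕ → ℚ
dQ d = (+ d) ℚ./ 1

oneF : QF
oneF = 1ℚ , 0ℚ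

mulF : ℕ → QF → QF → QF
mulF d (x₁ , y₁) (x₂ , y₂) = (x₁ * x₂ + dQ d * (y₁ * y₂)) , (x₁ * y₂ + x₂ * y₁)

negF : QF → QF
negF (x , y) = (- x) , (- y)

subF : QF → QF → QF
subF (x₁ , y₁) (x₂ , y₂) = (x₁ - x₂) , (y₁ - y₂)

normF : ℕ → QF → ℚ
normF d (x , y) = x * x - dQ d * (y * y)

traceF : QF → ℚ
traceF (x , y) = x + x

-- total division on ℚ (division by 0 returns 0; only used with nonzero divisors)
_÷'_ : ℚ → ℚ → ℚ
p ÷' q with q ≟ 0ℚ
... | yes _ = 0ℚ
... | no q≢0 = _÷_ p q {{ℚ.≢-nonZero q≢0}}

-- inverse in ℚ(√d): (x + y√d)⁻¹ = (x - y√d) / (x² - d y²)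
invF : ℕ → QF → QF
invF d (x , y) = (x ÷' normF d (x , y)) , ((- y) ÷' normF d (x , y))

powF : ℕ → QF → ℕ → QF
powF d ε zero = oneF
powF d ε (suc n) = mulF d (powF d ε n) ε

zpowF : ℕ → QF → ℤ → QF
zpowF d ε (+ n) = powF d ε n
zpowF d ε -[1+ n ] = invF d (powF d ε (suc n))

IsIntQ : ℚ → Set
IsIntQ q = ∃[ z ] q ≡ (z ℚ./ 1)

-- membership in the ring of integers 𝒪 of ℚ(√d): x + y√d is an algebraic
-- integer iff its trace and norm (coefficients of its characteristic
-- polynomial) are rational integers
InO : ℕ → QF → Set
InO d u = IsIntQ (traceF u) × IsIntQ (normF d u)

IsUnitO : ℕ → QF → Set
IsUnitO d u = InO d u × ∃[ v ] (InO d v × mulF d u v ≡ oneF)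

-- positivity of x + y√d as a real number (√d > 0 the positive root)
PosF : ℕ → QF → Set
PosF d (x , y) =
  (0ℚ ≤ x × 0ℚ ≤ y × (0ℚ < x ⊎ 0ℚ < y))
  ⊎ (0ℚ < x × y < 0ℚ × dQ d * (y * y) < x * x)
  ⊎ (x < 0ℚ × 0ℚ < y × x * x < dQ d * (y * y))

GtOneF : ℕ → QF → Set
GtOneF d u = PosF d (subF u oneF)

IsFundamentalUnit : ℕ → QF → Set
IsFundamentalUnit d ε =
  IsUnitO d ε × GtOneF d ε ×
  (∀ u → IsUnitO d u → ∃[ l ] (u ≡ zpowF d ε l ⊎ u ≡ negF (zpowF d ε l)))

aₙ : ℕ → QF → ℕ → ℚ
aₙ d ε n = proj₁ (powF d ε n)

Lₙ : ℕ → QF → ℕ → ℚ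
Lₙ d ε n = aₙ d ε n ÷' proj₁ ε

{-# OPTIONS --safe #-}
-- A unit of 𝒪 has the form ε = (t + p√d)/2 with t, p ∈ ℤ and t² − d p² = 4m, m = ±1:
-- t = Tr ε and m = N ε are integers, and d (2b)² = t² − 4m forces 2b ∈ ℤ as d is
-- square-free. Here t ≠ 0, since d p² = ±4 is impossible, so a = t/2 ≠ 0 and (ii) says
-- a₃ = a₁ + a₂; eliminating d p² this becomes t³ − t² − (3m + 1) t + 2m = 0. For m = 1
-- the cubic has no integer root (it never vanishes mod 3); for m = −1 it is
-- (t − 1)(t² + 2), so t = 1, d p² = 5, hence d = 5, p = ±1, and ε > 1 excludes p = −1.
-- Conversely φ = (1 + √5)/2 satisfies φ² = φ + 1, so the first coordinates of its
-- powers obey the Fibonacci recursion.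
module Submission where

open import Defs
open import Data.Nat using (ℕ; _<_; _≥_) renaming (_+_ to _+ℕ_)
open import Data.Rational using (ℚ; _+_; _/_)
open import Data.Integer using (+_)
open import Data.Product using (_×_; _,_)
open import Relation.Binary.PropositionalEquality using (_≡_)

open import Data.Nat as ℕ using (suc; zero; s≤s; z≤n)
import Data.Nat.Properties as ℕₚ
open import Data.Nat.Divisibility using (_∣_; divides; ∣-trans; ∣⇒≤)
open import Data.Nat.Coprimality as Coprimality using (Coprime; coprime-divisor)
open import Data.Integer as ℤ using (ℤ; -[1+_]; ∣_∣)
import Data.Integer.Properties as ℤₚ
open import Data.Integer.DivMod using (_%ℕ_; _/ℕ_; n%ℕd<d; a≡a%ℕn+[a/ℕn]*n)
open import Data.Integer.Tactic.RingSolver using () renaming (solve-∀ to solve-∀ℤ)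
open import Data.Rational as ℚ using (mkℚ; _*_; _-_; -_; 0ℚ; 1ℚ; ½; -½; 1/_; toℚᵘ)
open import Data.Rational.Properties
open import Data.Rational.Unnormalised as ℚᵘ using (mkℚᵘ; *≡*) renaming (_≃_ to _≃ᵘ_)
import Data.Rational.Unnormalised.Properties as ℚᵘₚ
open import Data.Product using (proj₁; proj₂; ∃-syntax)
open import Data.Sum using (_⊎_; inj₁; inj₂)
open import Function using (_∘_)
open import Level using (0ℓ)
open import Relation.Binary.PropositionalEquality
  using (_≢_; refl; sym; trans; cong; cong₂; subst; subst₂; module ≡-Reasoning)
open import Relation.Nullary using (¬_; yes; no; contradiction)
open import Relation.Nullary.Decidable using (dec⇒maybe; from-yes; from-no)
open import Tactic.RingSolver using (solve-∀)
open import Tactic.RingSolver.Core.AlmostCommutativeRing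
  using (AlmostCommutativeRing; fromCommutativeRing)

ℚ-ring : AlmostCommutativeRing 0ℓ 0ℓ
ℚ-ring = fromCommutativeRing +-*-commutativeRing (λ x → dec⇒maybe (0ℚ ≟ x))

ι : ℤ → ℚ
ι z = z / 1

toℚᵘ-ι : ∀ z → toℚᵘ (ι z) ≃ᵘ mkℚᵘ z 0
toℚᵘ-ι z = toℚᵘ-fromℚᵘ (mkℚᵘ z 0)

ι-homo-+ : ∀ x y → ι (x ℤ.+ y) ≡ ι x + ι y
ι-homo-+ x y = toℚᵘ-injective (begin
  toℚᵘ (ι (x ℤ.+ y))          ≈⟨ toℚᵘ-ι (x ℤ.+ y) ⟩
  mkℚᵘ (x ℤ.+ y) 0            ≈⟨ *≡* (cross-multiplied x y) ⟩
  mkℚᵘ x 0 ℚᵘ.+ mkℚᵘ y 0      ≈⟨ ℚᵘₚ.+-cong (ℚᵘₚ.≃-sym (toℚᵘ-ι x)) (ℚᵘₚ.≃-sym (toℚᵘ-ι y)) ⟩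
  toℚᵘ (ι x) ℚᵘ.+ toℚᵘ (ι y)  ≈⟨ ℚᵘₚ.≃-sym (toℚᵘ-homo-+ (ι x) (ι y)) ⟩
  toℚᵘ (ι x + ι y)            ∎)
  where
  open ℚᵘₚ.≃-Reasoning
  cross-multiplied : ∀ x y → (x ℤ.+ y) ℤ.* + 1 ≡ (x ℤ.* + 1 ℤ.+ y ℤ.* + 1) ℤ.* + 1
  cross-multiplied = solve-∀ℤ

ι-homo-* : ∀ x y → ι (x ℤ.* y) ≡ ι x * ι y
ι-homo-* x y = toℚᵘ-injective (begin
  toℚᵘ (ι (x ℤ.* y))          ≈⟨ toℚᵘ-ι (x ℤ.* y) ⟩
  mkℚᵘ (x ℤ.* y) 0            ≈⟨ ℚᵘₚ.≃-refl ⟩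
  mkℚᵘ x 0 ℚᵘ.* mkℚᵘ y 0      ≈⟨ ℚᵘₚ.*-cong (ℚᵘₚ.≃-sym (toℚᵘ-ι x)) (ℚᵘₚ.≃-sym (toℚᵘ-ι y)) ⟩
  toℚᵘ (ι x) ℚᵘ.* toℚᵘ (ι y)  ≈⟨ ℚᵘₚ.≃-sym (toℚᵘ-homo-* (ι x) (ι y)) ⟩
  toℚᵘ (ι x * ι y)            ∎)
  where open ℚᵘₚ.≃-Reasoning

ι-homo‿- : ∀ x → ι (ℤ.- x) ≡ - ι x
ι-homo‿- x = toℚᵘ-injective (begin
  toℚᵘ (ι (ℤ.- x))     ≈⟨ toℚᵘ-ι (ℤ.- x) ⟩
  mkℚᵘ (ℤ.- x) 0       ≈⟨ ℚᵘₚ.≃-refl ⟩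
  ℚᵘ.- mkℚᵘ x 0        ≈⟨ ℚᵘₚ.-‿cong (ℚᵘₚ.≃-sym (toℚᵘ-ι x)) ⟩
  ℚᵘ.- toℚᵘ (ι x)      ≈⟨ ℚᵘₚ.≃-sym (toℚᵘ-homo‿- (ι x)) ⟩
  toℚᵘ (- ι x)         ∎)
  where open ℚᵘₚ.≃-Reasoning

ι-injective : ∀ {x y} → ι x ≡ ι y → x ≡ y
ι-injective {x} {y} eq with ℚᵘₚ.≃-trans (ℚᵘₚ.≃-sym (toℚᵘ-ι x)) (ℚᵘₚ.≃-trans (toℚᵘ-cong eq) (toℚᵘ-ι y))
... | *≡* x*1≡y*1 = trans (sym (ℤₚ.*-identityʳ x)) (trans x*1≡y*1 (ℤₚ.*-identityʳ y))

-- Integer polynomial expressions: since ι is an injective ring homomorphism, an identity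
-- between their values in ℚ already holds in ℤ.
infixl 6 _⊕_ _⊖_
infixl 7 _⊗_

data Expr : Set where
  con     : ℤ → Expr
  _⊕_ _⊗_ : Expr → Expr → Expr
  ⊝_      : Expr → Expr

_⊖_ : Expr → Expr → Expr
x ⊖ y = x ⊕ ⊝ y

⟦_⟧ℤ : Expr → ℤ
⟦ con z ⟧ℤ = z
⟦ x ⊕ y ⟧ℤ = ⟦ x ⟧ℤ ℤ.+ ⟦ y ⟧ℤ
⟦ x ⊗ y ⟧ℤ = ⟦ x ⟧ℤ ℤ.* ⟦ y ⟧ℤ
⟦ ⊝ x ⟧ℤ   = ℤ.- ⟦ x ⟧ℤ

⟦_⟧ℚ : Expr → ℚ
⟦ con z ⟧ℚ = ι z
⟦ x ⊕ y ⟧ℚ = ⟦ x ⟧ℚ + ⟦ y ⟧ℚ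
⟦ x ⊗ y ⟧ℚ = ⟦ x ⟧ℚ * ⟦ y ⟧ℚ
⟦ ⊝ x ⟧ℚ   = - ⟦ x ⟧ℚ

ι-⟦⟧ : ∀ e → ι ⟦ e ⟧ℤ ≡ ⟦ e ⟧ℚ
ι-⟦⟧ (con z) = refl
ι-⟦⟧ (x ⊕ y) = trans (ι-homo-+ ⟦ x ⟧ℤ ⟦ y ⟧ℤ) (cong₂ _+_ (ι-⟦⟧ x) (ι-⟦⟧ y))
ι-⟦⟧ (x ⊗ y) = trans (ι-homo-* ⟦ x ⟧ℤ ⟦ y ⟧ℤ) (cong₂ _*_ (ι-⟦⟧ x) (ι-⟦⟧ y))
ι-⟦⟧ (⊝ x)   = trans (ι-homo‿- ⟦ x ⟧ℤ) (cong -_ (ι-⟦⟧ x))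

⟦⟧ℚ≡⇒⟦⟧ℤ≡ : ∀ e₁ e₂ → ⟦ e₁ ⟧ℚ ≡ ⟦ e₂ ⟧ℚ → ⟦ e₁ ⟧ℤ ≡ ⟦ e₂ ⟧ℤ
⟦⟧ℚ≡⇒⟦⟧ℤ≡ e₁ e₂ eq = ι-injective (trans (ι-⟦⟧ e₁) (trans eq (sym (ι-⟦⟧ e₂))))

⟦⟧ℤ≡⇒⟦⟧ℚ≡ : ∀ e₁ e₂ → ⟦ e₁ ⟧ℤ ≡ ⟦ e₂ ⟧ℤ → ⟦ e₁ ⟧ℚ ≡ ⟦ e₂ ⟧ℚ
⟦⟧ℤ≡⇒⟦⟧ℚ≡ e₁ e₂ eq = trans (sym (ι-⟦⟧ e₁)) (trans (cong ι eq) (ι-⟦⟧ e₂))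

÷'-distribʳ-+ : ∀ x y c → (x + y) ÷' c ≡ x ÷' c + y ÷' c
÷'-distribʳ-+ x y c with c ≟ 0ℚ
... | yes _ = sym (+-identityˡ 0ℚ)
... | no  _ = *-distribʳ-+ _ x y

÷'-cancelʳ : ∀ {x y c} → c ≢ 0ℚ → x ÷' c ≡ y ÷' c → x ≡ y
÷'-cancelʳ {x} {y} {c} c≢0 eq with c ≟ 0ℚ
... | yes c≡0 = contradiction c≡0 c≢0
... | no  _   = trans (sym (÷*-cancel x)) (trans (cong (_* c) eq) (÷*-cancel y))
  where
  instance
    c≢0′ : ℚ.NonZero c
    c≢0′ = ℚ.≢-nonZero c≢0
  ÷*-cancel : ∀ z → z * 1/ c * c ≡ z
  ÷*-cancel z = trans (*-assoc z (1/ c) c) (trans (cong (z *_) (*-inverseˡ c)) (*-identityʳ z))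

x≡[x+x]*½ : ∀ x → x ≡ (x + x) * ½
x≡[x+x]*½ = solve-∀ ℚ-ring

ι[t]*½≡0⇒t≡0 : ∀ {t} → ι t * ½ ≡ 0ℚ → t ≡ + 0
ι[t]*½≡0⇒t≡0 {t} eq = ι-injective (trans (double (ι t)) (cong (λ x → x + x) eq))
  where
  double : ∀ x → x ≡ x * ½ + x * ½
  double = solve-∀ ℚ-ring

i*i≡∣i∣*∣i∣ : ∀ i → i ℤ.* i ≡ + (∣ i ∣ ℕ.* ∣ i ∣)
i*i≡∣i∣*∣i∣ (+ n)    = sym (ℤₚ.pos-* n n)
i*i≡∣i∣*∣i∣ -[1+ n ] = refl

∣i∣≡1⇒i≡±1 : ∀ {i} → ∣ i ∣ ≡ 1 → i ≡ + 1 ⊎ i ≡ -[1+ 0 ]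
∣i∣≡1⇒i≡±1 {+ 1}      _ = inj₁ refl
∣i∣≡1⇒i≡±1 { -[1+ 0 ]} _ = inj₂ refl

d*p*p≡+d∣p∣² : ∀ d p → + d ℤ.* (p ℤ.* p) ≡ + (d ℕ.* (∣ p ∣ ℕ.* ∣ p ∣))
d*p*p≡+d∣p∣² d p = trans (cong (+ d ℤ.*_) (i*i≡∣i∣*∣i∣ p)) (sym (ℤₚ.pos-* d _))

d*p*p≡+k⇒d∣p∣²≡k : ∀ d p {k} → + d ℤ.* (p ℤ.* p) ≡ + k → d ℕ.* (∣ p ∣ ℕ.* ∣ p ∣) ≡ k
d*p*p≡+k⇒d∣p∣²≡k d p eq = ℤₚ.+-injective (trans (sym (d*p*p≡+d∣p∣² d p)) eq)

d*P²<8⇒P≡1 : ∀ {d} P {k} → 1 < d → d ℕ.* (P ℕ.* P) ≡ suc k → suc k < 8 → P ≡ 1 × d ≡ suc k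
d*P²<8⇒P≡1 {d} zero          _   eq _ = contradiction (trans (sym (ℕₚ.*-zeroʳ d)) eq) λ ()
d*P²<8⇒P≡1 {d} (suc zero)    _   eq _ = refl , trans (sym (ℕₚ.*-identityʳ d)) eq
d*P²<8⇒P≡1 {d} (suc (suc P)) 1<d eq k<8 =
  contradiction (ℕₚ.≤-trans (ℕₚ.*-mono-≤ 1<d (ℕₚ.*-mono-≤ 2≤P 2≤P)) (ℕₚ.≤-reflexive eq)) (ℕₚ.<⇒≱ k<8)
  where
  2≤P : 2 ℕ.≤ suc (suc P)
  2≤P = s≤s (s≤s z≤n)

3∤2 : ∀ k → ∣ + 3 ℤ.* k ∣ ≢ 2
3∤2 k eq = contradiction (∣⇒≤ 3∣2) λ { (s≤s (s≤s ())) }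
  where
  3∣2 : 3 ∣ 2
  3∣2 = divides ∣ k ∣ (trans (sym eq) (trans (ℤₚ.abs-* (+ 3) k) (ℕₚ.*-comm 3 ∣ k ∣)))

coprime-*ˡ : ∀ {a b c} → Coprime a c → Coprime b c → Coprime (a ℕ.* b) c
coprime-*ˡ a⊥c b⊥c (g∣ab , g∣c) =
  b⊥c (coprime-divisor (Coprimality.sym λ (h∣a , h∣g) → a⊥c (h∣a , ∣-trans h∣g g∣c)) g∣ab , g∣c)

-- The denominator q of e satisfies q² ∣ d, as e is in lowest terms.
squareFree⇒integral : ∀ {d} → SquareFree d → ∀ e → IsIntQ (dQ d * (e * e)) → IsIntQ e
squareFree⇒integral sf e@(mkℚ n zero _) _ = n , sym (↥p/↧p≡p e)
squareFree⇒integral {d} sf e@(mkℚ n (suc k) n⊥q) (c , eq) = contradiction (sf q q²∣d) λ ()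
  where
  q P : ℕ
  q = suc (suc k)
  P = ∣ n ∣

  in-ℚᵘ : mkℚᵘ (+ d) 0 ℚᵘ.* (mkℚᵘ n (suc k) ℚᵘ.* mkℚᵘ n (suc k)) ≃ᵘ mkℚᵘ c 0
  in-ℚᵘ = begin
    mkℚᵘ (+ d) 0 ℚᵘ.* (toℚᵘ e ℚᵘ.* toℚᵘ e) ≈⟨ ℚᵘₚ.*-cong (ℚᵘₚ.≃-sym (toℚᵘ-ι (+ d))) (ℚᵘₚ.≃-sym (toℚᵘ-homo-* e e)) ⟩
    toℚᵘ (dQ d) ℚᵘ.* toℚᵘ (e * e)          ≈⟨ ℚᵘₚ.≃-sym (toℚᵘ-homo-* (dQ d) (e * e)) ⟩
    toℚᵘ (dQ d * (e * e))                  ≈⟨ toℚᵘ-cong eq ⟩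
    toℚᵘ (ι c)                             ≈⟨ toℚᵘ-ι c ⟩
    mkℚᵘ c 0                               ∎
    where open ℚᵘₚ.≃-Reasoning

  cross : + d ℤ.* (n ℤ.* n) ℤ.* + 1 ≡ c ℤ.* + (q ℕ.* q ℕ.+ 0)
  cross with in-ℚᵘ
  ... | *≡* eq′ = eq′

  dP²≡cq² : d ℕ.* (P ℕ.* P) ≡ ∣ c ∣ ℕ.* (q ℕ.* q)
  dP²≡cq² = begin
    d ℕ.* (P ℕ.* P)                      ≡⟨ cong (d ℕ.*_) (sym (ℤₚ.abs-* n n)) ⟩
    d ℕ.* ∣ n ℤ.* n ∣                    ≡⟨ sym (ℤₚ.abs-* (+ d) (n ℤ.* n)) ⟩
    ∣ + d ℤ.* (n ℤ.* n) ∣                ≡⟨ cong ∣_∣ (sym (ℤₚ.*-identityʳ (+ d ℤ.* (n ℤ.* n)))) ⟩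
    ∣ + d ℤ.* (n ℤ.* n) ℤ.* + 1 ∣        ≡⟨ cong ∣_∣ cross ⟩
    ∣ c ℤ.* + (q ℕ.* q ℕ.+ 0) ∣          ≡⟨ ℤₚ.abs-* c _ ⟩
    ∣ c ∣ ℕ.* (q ℕ.* q ℕ.+ 0)            ≡⟨ cong (∣ c ∣ ℕ.*_) (ℕₚ.+-identityʳ _) ⟩
    ∣ c ∣ ℕ.* (q ℕ.* q)                  ∎
    where open ≡-Reasoning

  P⊥q : Coprime P q
  P⊥q = Coprimality.recompute n⊥q

  q²⊥P² : Coprime (q ℕ.* q) (P ℕ.* P)
  q²⊥P² = Coprimality.sym (coprime-*ˡ P⊥q² P⊥q²)
    where
    P⊥q² : Coprime P (q ℕ.* q)
    P⊥q² = Coprimality.sym (coprime-*ˡ (Coprimality.sym P⊥q) (Coprimality.sym P⊥q))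

  q²∣d : q ℕ.* q ∣ d
  q²∣d = coprime-divisor q²⊥P² (divides ∣ c ∣ (trans (ℕₚ.*-comm (P ℕ.* P) d) dP²≡cq²))

normF-mulF : ∀ d u v → normF d (mulF d u v) ≡ normF d u * normF d v
normF-mulF d (a , b) (x , y) = identity a b x y (dQ d)
  where
  identity : ∀ a b x y D →
    (a * x + D * (b * y)) * (a * x + D * (b * y)) - D * ((a * y + x * b) * (a * y + x * b))
      ≡ (a * a - D * (b * b)) * (x * x - D * (y * y))
  identity = solve-∀ ℚ-ring

normF-oneF : ∀ d → normF d oneF ≡ 1ℚ
normF-oneF d = identity (dQ d)
  where
  identity : ∀ D → 1ℚ * 1ℚ - D * (0ℚ * 0ℚ) ≡ 1ℚ
  identity = solve-∀ ℚ-ring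

unit⇒norm≡±1 : ∀ {d u} → IsUnitO d u → ∃[ m ] (normF d u ≡ ι m × (m ≡ + 1 ⊎ m ≡ -[1+ 0 ]))
unit⇒norm≡±1 {d} {u} ((_ , (m , Nu≡m)) , v , (_ , (n , Nv≡n)) , uv≡1) =
  m , Nu≡m , ∣i∣≡1⇒i≡±1 (ℕₚ.m*n≡1⇒m≡1 ∣ m ∣ ∣ n ∣ (trans (sym (ℤₚ.abs-* m n)) (cong ∣_∣ mn≡1)))
  where
  mn≡1 : m ℤ.* n ≡ + 1
  mn≡1 = ι-injective (begin
    ι (m ℤ.* n)                      ≡⟨ ι-homo-* m n ⟩
    ι m * ι n                        ≡⟨ sym (cong₂ _*_ Nu≡m Nv≡n) ⟩
    normF d u * normF d v            ≡⟨ sym (normF-mulF d u v) ⟩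
    normF d (mulF d u v)             ≡⟨ cong (normF d) uv≡1 ⟩
    normF d oneF                     ≡⟨ normF-oneF d ⟩
    ι (+ 1)                          ∎)
    where open ≡-Reasoning

record HalfIntegral (d : ℕ) (u : QF) : Set where
  field
    t p m  : ℤ
    x≡t/2  : proj₁ u ≡ ι t * ½
    y≡p/2  : proj₂ u ≡ ι p * ½
    m≡±1   : m ≡ + 1 ⊎ m ≡ -[1+ 0 ]
    pell   : + d ℤ.* (p ℤ.* p) ≡ t ℤ.* t ℤ.- + 4 ℤ.* m

discriminant : ∀ d x y → dQ d * ((y + y) * (y + y)) ≡ (x + x) * (x + x) - ι (+ 4) * normF d (x , y)
discriminant d x y = identity x y (dQ d)
  where
  identity : ∀ x y D → D * ((y + y) * (y + y)) ≡ (x + x) * (x + x) - ι (+ 4) * (x * x - D * (y * y))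
  identity = solve-∀ ℚ-ring

unit⇒halfIntegral : ∀ {d u} → SquareFree d → IsUnitO d u → HalfIntegral d u
unit⇒halfIntegral {d} {x , y} sf unit@(((t , x+x≡t) , _) , _) = fromNorm (unit⇒norm≡±1 {d} {x , y} unit)
  where
  fromNorm : ∃[ m ] (normF d (x , y) ≡ ι m × (m ≡ + 1 ⊎ m ≡ -[1+ 0 ])) → HalfIntegral d (x , y)
  fromNorm (m , Nu≡m , m≡±1) = record
    { t = t ; p = p ; m = m
    ; x≡t/2 = trans (x≡[x+x]*½ x) (cong (_* ½) x+x≡t)
    ; y≡p/2 = trans (x≡[x+x]*½ y) (cong (_* ½) y+y≡p)
    ; m≡±1 = m≡±1
    ; pell = ⟦⟧ℚ≡⇒⟦⟧ℤ≡ (con (+ d) ⊗ (con p ⊗ con p)) disc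
                        (subst (λ z → dQ d * (z * z) ≡ ⟦ disc ⟧ℚ) y+y≡p d[y+y]²≡disc)
    }
    where
    disc : Expr
    disc = con t ⊗ con t ⊖ con (+ 4) ⊗ con m

    d[y+y]²≡disc : dQ d * ((y + y) * (y + y)) ≡ ⟦ disc ⟧ℚ
    d[y+y]²≡disc = trans (discriminant d x y) (cong₂ (λ a b → a * a - ι (+ 4) * b) x+x≡t Nu≡m)

    y+y-integral : IsIntQ (y + y)
    y+y-integral = squareFree⇒integral sf (y + y) (⟦ disc ⟧ℤ , trans d[y+y]²≡disc (sym (ι-⟦⟧ disc)))

    p : ℤ
    p = proj₁ y+y-integral

    y+y≡p : y + y ≡ ι p
    y+y≡p = proj₂ y+y-integral

halfIntegral-t≢0 : ∀ {d u} → 1 < d → SquareFree d → (h : HalfIntegral d u) → HalfIntegral.t h ≢ + 0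
halfIntegral-t≢0 {d} _ _ record { p = p ; m≡±1 = inj₁ refl ; pell = pell } refl =
  contradiction (trans (sym (d*p*p≡+d∣p∣² d p)) pell) λ ()
halfIntegral-t≢0 {d} 1<d sf record { p = p ; m≡±1 = inj₂ refl ; pell = pell } refl
  with d*P²<8⇒P≡1 ∣ p ∣ 1<d (d*p*p≡+k⇒d∣p∣²≡k d p pell) (from-yes (4 ℕ.<? 8))
... | _ , refl = contradiction (sf 2 (divides 1 refl)) λ ()

-- a₃ = a₁ + a₂ turns into cubic t m = 0 once d p² = t² − 4m is substituted; see fibonacci-defect.
cubic : ℤ → ℤ → ℤ
cubic t m = t ℤ.* t ℤ.* t ℤ.- t ℤ.* t ℤ.- (+ 3 ℤ.* m ℤ.+ + 1) ℤ.* t ℤ.+ + 2 ℤ.* m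

cubicᴱ : ℤ → ℤ → Expr
cubicᴱ t m = T ⊗ T ⊗ T ⊖ T ⊗ T ⊖ (con (+ 3) ⊗ con m ⊕ con (+ 1)) ⊗ T ⊕ con (+ 2) ⊗ con m
  where
  T : Expr
  T = con t

-- Modulo 3 the cubic takes the values 2, 1, 1 at t = 0, 1, 2.
cubic-+1≢0 : ∀ t → cubic t (+ 1) ≢ + 0
cubic-+1≢0 t cubic≡0 = residue r (n%ℕd<d t 3) (ℤₚ.i-j≡0⇒i≡j _ _ (begin
    cubic (+ r) (+ 1) ℤ.- + 3 ℤ.* K (+ r) q  ≡⟨ sym (shift (+ r) q) ⟩
    cubic (+ r ℤ.+ q ℤ.* + 3) (+ 1)          ≡⟨ cong (λ z → cubic z (+ 1)) (sym (a≡a%ℕn+[a/ℕn]*n t 3)) ⟩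
    cubic t (+ 1)                            ≡⟨ cubic≡0 ⟩
    + 0                                      ∎))
  where
  open ≡-Reasoning
  r : ℕ
  r = t %ℕ 3
  q : ℤ
  q = t /ℕ 3

  K : ℤ → ℤ → ℤ
  K r q = + 2 ℤ.* r ℤ.* q ℤ.+ + 3 ℤ.* (q ℤ.* q) ℤ.+ + 4 ℤ.* q
          ℤ.- + 3 ℤ.* (r ℤ.* r) ℤ.* q ℤ.- + 9 ℤ.* r ℤ.* (q ℤ.* q) ℤ.- + 9 ℤ.* (q ℤ.* q ℤ.* q)

  shift : ∀ r q → let s = r ℤ.+ q ℤ.* + 3 in
    s ℤ.* s ℤ.* s ℤ.- s ℤ.* s ℤ.- + 4 ℤ.* s ℤ.+ + 2
      ≡ r ℤ.* r ℤ.* r ℤ.- r ℤ.* r ℤ.- + 4 ℤ.* r ℤ.+ + 2 ℤ.- + 3 ℤ.*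
          (+ 2 ℤ.* r ℤ.* q ℤ.+ + 3 ℤ.* (q ℤ.* q) ℤ.+ + 4 ℤ.* q
           ℤ.- + 3 ℤ.* (r ℤ.* r) ℤ.* q ℤ.- + 9 ℤ.* r ℤ.* (q ℤ.* q) ℤ.- + 9 ℤ.* (q ℤ.* q ℤ.* q))
  shift = solve-∀ℤ

  residue : ∀ r {k} → r < 3 → cubic (+ r) (+ 1) ≢ + 3 ℤ.* k
  residue 0 {k} _ eq = 3∤2 k (cong ∣_∣ (sym eq))
  residue 1 {k} _ eq = 3∤2 k (cong ∣_∣ (sym eq))
  residue 2 {k} _ eq = 3∤2 k (cong ∣_∣ (sym eq))
  residue (suc (suc (suc _))) (s≤s (s≤s (s≤s ())))

cubic-−1≡0⇒t≡1 : ∀ {t} → cubic t -[1+ 0 ] ≡ + 0 → t ≡ + 1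
cubic-−1≡0⇒t≡1 {t} cubic≡0 with ℤₚ.i*j≡0⇒i≡0∨j≡0 (t ℤ.- + 1) (trans (sym (factorisation t)) cubic≡0)
  where
  factorisation : ∀ t → t ℤ.* t ℤ.* t ℤ.- t ℤ.* t ℤ.- (+ 3 ℤ.* -[1+ 0 ] ℤ.+ + 1) ℤ.* t ℤ.+ + 2 ℤ.* -[1+ 0 ]
                        ≡ (t ℤ.- + 1) ℤ.* (t ℤ.* t ℤ.+ + 2)
  factorisation = solve-∀ℤ
... | inj₁ t-1≡0  = ℤₚ.i-j≡0⇒i≡j t (+ 1) t-1≡0
... | inj₂ t²+2≡0 = contradiction (ℕₚ.m+n≡0⇒n≡0 (∣ t ∣ ℕ.* ∣ t ∣) (ℤₚ.+-injective t²+2≡0′)) λ ()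
  where
  t²+2≡0′ : + (∣ t ∣ ℕ.* ∣ t ∣) ℤ.+ + 2 ≡ + 0
  t²+2≡0′ = trans (cong (ℤ._+ + 2) (sym (i*i≡∣i∣*∣i∣ t))) t²+2≡0

-- x₁, x₂, x₃ are the first coordinates of u, u², u³ for u = (T + P√D)/2, unfolded as powF computes them.
fibonacci-defect : ∀ T P M D →
  let A = T * ½ ; B = P * ½
      x₁ = 1ℚ * A + D * (0ℚ * B) ; y₁ = 1ℚ * B + A * 0ℚ
      x₂ = x₁ * A + D * (y₁ * B) ; y₂ = x₁ * B + A * y₁
      x₃ = x₂ * A + D * (y₂ * B)
  in T * T * T - T * T - (ι (+ 3) * M + ι (+ 1)) * T + ι (+ 2) * M
       ≡ ι (+ 2) * (x₃ - (x₁ + x₂)) - (ι (+ 3) * T - ι (+ 2)) * ½ * ½ * (D * (P * P) - (T * T - ι (+ 4) * M))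
fibonacci-defect = solve-∀ ℚ-ring

fibonacci⇒cubic≡0 : ∀ {d a b} (h : HalfIntegral d (a , b)) → a ≢ 0ℚ →
  Lₙ d (a , b) 3 ≡ Lₙ d (a , b) 1 + Lₙ d (a , b) 2 → cubic (HalfIntegral.t h) (HalfIntegral.m h) ≡ + 0
fibonacci⇒cubic≡0 {d} {a} {b} h a≢0 L₃≡L₁+L₂ = ⟦⟧ℚ≡⇒⟦⟧ℤ≡ (cubicᴱ t m) (con (+ 0)) (begin
  ⟦ cubicᴱ t m ⟧ℚ                                        ≡⟨ fibonacci-defect (ι t) (ι p) (ι m) (dQ d) ⟩
  ι (+ 2) * (aₙ d u 3 - (aₙ d u 1 + aₙ d u 2)) - c * (dQ d * (ι p * ι p) - disc)
    ≡⟨ cong₂ (λ x X → ι (+ 2) * (x - (aₙ d u 1 + aₙ d u 2)) - c * (X - disc)) a₃≡a₁+a₂ ℚ-pell ⟩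
  ι (+ 2) * (a₁+a₂ - a₁+a₂) - c * (disc - disc)          ≡⟨ cancel a₁+a₂ c disc ⟩
  0ℚ                                                     ∎)
  where
  open ≡-Reasoning
  open HalfIntegral h

  u : QF
  u = ι t * ½ , ι p * ½

  c disc a₁+a₂ : ℚ
  c = (ι (+ 3) * ι t - ι (+ 2)) * ½ * ½
  disc = ι t * ι t - ι (+ 4) * ι m
  a₁+a₂ = aₙ d u 1 + aₙ d u 2

  a₃≡a₁+a₂ : aₙ d u 3 ≡ a₁+a₂
  a₃≡a₁+a₂ = subst₂ (λ x y → aₙ d (x , y) 3 ≡ aₙ d (x , y) 1 + aₙ d (x , y) 2) x≡t/2 y≡p/2
               (÷'-cancelʳ a≢0 (trans L₃≡L₁+L₂ (sym (÷'-distribʳ-+ _ _ a))))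

  ℚ-pell : dQ d * (ι p * ι p) ≡ disc
  ℚ-pell = ⟦⟧ℤ≡⇒⟦⟧ℚ≡ (con (+ d) ⊗ (con p ⊗ con p)) (con t ⊗ con t ⊖ con (+ 4) ⊗ con m) pell

  cancel : ∀ w c v → ι (+ 2) * (w - w) - c * (v - v) ≡ 0ℚ
  cancel = solve-∀ ℚ-ring

conjugate-golden≯1 : ¬ GtOneF 5 (½ , -½)
conjugate-golden≯1 (inj₁ (0≤x , _))            = from-no (0ℚ ≤? (½ - 1ℚ)) 0≤x
conjugate-golden≯1 (inj₂ (inj₁ (0<x , _)))     = from-no (0ℚ <? (½ - 1ℚ)) 0<x
conjugate-golden≯1 (inj₂ (inj₂ (_ , 0<y , _))) = from-no (0ℚ <? (-½ - 0ℚ)) 0<y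

cubic≡0⇒golden : ∀ {d a b} → 1 < d → GtOneF d (a , b) → (h : HalfIntegral d (a , b)) →
  cubic (HalfIntegral.t h) (HalfIntegral.m h) ≡ + 0 → d ≡ 5 × (a , b) ≡ (½ , ½)
cubic≡0⇒golden _ _ record { t = t ; m≡±1 = inj₁ refl } cubic≡0 = contradiction cubic≡0 (cubic-+1≢0 t)
cubic≡0⇒golden {d} {a} {b} 1<d ε>1 record { t = t ; p = p ; m≡±1 = inj₂ refl ; x≡t/2 = a≡t/2 ; y≡p/2 = b≡p/2 ; pell = pell } cubic≡0
  with cubic-−1≡0⇒t≡1 {t} cubic≡0
... | refl with d*P²<8⇒P≡1 ∣ p ∣ 1<d (d*p*p≡+k⇒d∣p∣²≡k d p pell) (from-yes (5 ℕ.<? 8))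
...   | ∣p∣≡1 , d≡5 with ∣i∣≡1⇒i≡±1 {p} ∣p∣≡1
...     | inj₁ refl = d≡5 , cong₂ _,_ a≡t/2 b≡p/2
...     | inj₂ refl = contradiction (subst₂ GtOneF d≡5 (cong₂ _,_ a≡t/2 b≡p/2) ε>1) conjugate-golden≯1

fibonacci⇒golden : ∀ {d ε} → 1 < d → SquareFree d → IsFundamentalUnit d ε →
  Lₙ d ε 3 ≡ Lₙ d ε 1 + Lₙ d ε 2 → d ≡ 5 × ε ≡ (½ , ½)
fibonacci⇒golden {d} {a , b} 1<d sf (unit , ε>1 , _) L₃≡L₁+L₂ =
  cubic≡0⇒golden 1<d ε>1 h (fibonacci⇒cubic≡0 h a≢0 L₃≡L₁+L₂)
  where
  h : HalfIntegral d (a , b)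
  h = unit⇒halfIntegral sf unit

  -- needed because x ÷' 0 = 0: for a = 0 condition (ii) would hold trivially
  a≢0 : a ≢ 0ℚ
  a≢0 = halfIntegral-t≢0 1<d sf h ∘ ι[t]*½≡0⇒t≡0 ∘ trans (sym (HalfIntegral.x≡t/2 h))

golden-fibonacci : ∀ n → Lₙ 5 (½ , ½) (n +ℕ 2) ≡ Lₙ 5 (½ , ½) n + Lₙ 5 (½ , ½) (n +ℕ 1)
golden-fibonacci n rewrite ℕₚ.+-comm n 2 | ℕₚ.+-comm n 1 =
  trans (cong (_÷' ½) (φ²≡φ+1 (powF 5 (½ , ½) n))) (÷'-distribʳ-+ (aₙ 5 (½ , ½) n) (aₙ 5 (½ , ½) (suc n)) ½)
  where
  φ²≡φ+1 : ∀ u → proj₁ (mulF 5 (mulF 5 u (½ , ½)) (½ , ½)) ≡ proj₁ u + proj₁ (mulF 5 u (½ , ½))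
  φ²≡φ+1 (x , y) = identity x y
    where
    identity : ∀ x y → (x * ½ + dQ 5 * (y * ½)) * ½ + dQ 5 * ((x * ½ + ½ * y) * ½)
                       ≡ x + (x * ½ + dQ 5 * (y * ½))
    identity = solve-∀ ℚ-ring

corollary15 : ∀ (d : ℕ) → 1 < d → SquareFree d → ∀ (ε : QF) → IsFundamentalUnit d ε →
    let condI = ∀ (n : ℕ) → n ≥ 1 → Lₙ d ε (n +ℕ 2) ≡ Lₙ d ε n + Lₙ d ε (n +ℕ 1)
        condII = Lₙ d ε 3 ≡ Lₙ d ε 1 + Lₙ d ε 2
        condIII = d ≡ 5 × ε ≡ ((+ 1) / 2 , (+ 1) / 2)
    in (condI → condII) × (condII → condIII) × (condIII → condI)
corollary15 d 1<d sf ε fundamental =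
    (λ fibonacci → fibonacci 1 (s≤s z≤n))
  , fibonacci⇒golden 1<d sf fundamental
  , λ { (refl , refl) n _ → golden-fibonacci n }
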